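{- If $1 \leq t < r \leq n$ are integers, then $l(\mathsf{P}_{n,r},t) = s_{n-t,r-t}$.
   Context: A partition of a set $X$ of length $r$ is a set $\{X_1,\dots,X_r\}$ of pairwise disjoint non-empty sets (parts) whose union is $X$; $\mathsf{P}_{n,r}$ is the family of all partitions of $[n]$ of length $r$ (each partition is a set of parts), and $s_{n,r}=|\mathsf{P}_{n,r}|$. For a family $\mathcal{F}$, $\mathcal{F}(T)=\{F\in\mathcal{F}:T\subseteq F\}$ and $l(\mathcal{F},t)=\max\{|\mathcal{F}(T)|:|T|=t\}$. -}

module Defs where

open import Data.Bool using (Bool; true; false; _∧_; _∨_; not)
open import Data.Nat using (ℕ; zero; suc; _≡ᵇ_; _⊔_)
open import Data.Product using (_×_; _,_)
open import Data.List using (List; []; _∷_; _++_; map; concatMap; filterᵇ; length; foldr; allFin)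
open import Data.Bool.ListAction using (all; any)
open import Data.Vec using (Vec; []; _∷_; lookup)
open import Data.Fin.Subset using (Subset; _∩_)

subsets : (n : ℕ) → List (Subset n)
subsets zero    = [] ∷ []
subsets (suc n) = map (false ∷_) (subsets n) ++ map (true ∷_) (subsets n)

nonemptyᵇ : ∀ {n} → Subset n → Bool
nonemptyᵇ []      = false
nonemptyᵇ (b ∷ S) = b ∨ nonemptyᵇ S

disjointᵇ : ∀ {n} → Subset n → Subset n → Bool
disjointᵇ S S′ = not (nonemptyᵇ (S ∩ S′))

-- A set of subsets of [n] (e.g. a partition = set of its parts, or a
-- set T of t parts), stored canonically as its characteristic function
-- tabulated as a binary tree: for n = suc m, the pair
-- (members not containing 0 , members containing 0).
-- Two set systems are equal (≡) iff they have the same members.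

SetSys : ℕ → Set
SetSys zero    = Bool
SetSys (suc n) = SetSys n × SetSys n

_∈ₛ_ : ∀ {n} → Subset n → SetSys n → Bool
_∈ₛ_ {zero}  []        b       = b
_∈ₛ_ {suc n} (false ∷ S) (A , B) = S ∈ₛ A
_∈ₛ_ {suc n} (true ∷ S)  (A , B) = S ∈ₛ B

allSetSys : (n : ℕ) → List (SetSys n)
allSetSys zero    = true ∷ false ∷ []
allSetSys (suc n) = concatMap (λ A → map (A ,_) (allSetSys n)) (allSetSys n)

members : ∀ {n} → SetSys n → List (Subset n)
members {n} X = filterᵇ (_∈ₛ X) (subsets n)

size : ∀ {n} → SetSys n → ℕ
size X = length (members X)

_⊆ₛ_ : ∀ {n} → SetSys n → SetSys n → Bool
T ⊆ₛ X = all (_∈ₛ X) (members T)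

pairwiseDisjointᵇ : ∀ {n} → List (Subset n) → Bool
pairwiseDisjointᵇ []       = true
pairwiseDisjointᵇ (S ∷ Ss) = all (disjointᵇ S) Ss ∧ pairwiseDisjointᵇ Ss

coversᵇ : ∀ {n} → List (Subset n) → Bool
coversᵇ {n} Ss = all (λ i → any (λ S → lookup S i) Ss) (allFin n)

isPartitionᵇ : ∀ {n} → ℕ → SetSys n → Bool
isPartitionᵇ r X =
  all nonemptyᵇ (members X) ∧ pairwiseDisjointᵇ (members X)
  ∧ coversᵇ (members X) ∧ (size X ≡ᵇ r)

Family : ℕ → Set
Family n = List (SetSys n)

P : (n r : ℕ) → Family n
P n r = filterᵇ (isPartitionᵇ r) (allSetSys n)

s : ℕ → ℕ → ℕ
s n r = length (P n r)

_[_] : ∀ {n} → Family n → SetSys n → Family n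
F [ T ] = filterᵇ (T ⊆ₛ_) F

-- l(F,t) = max { |F(T)| : T a set of subsets of [n], |T| = t }
-- (maximum of a list of naturals; there is always such T here)
l : ∀ {n} → Family n → ℕ → ℕ
l {n} F t = foldr _⊔_ 0
  (map (λ T → length (F [ T ])) (filterᵇ (λ T → size T ≡ᵇ t) (allSetSys n)))

-- Lower bound: the t singletons 𝒯 = {{0}, …, {t − 1}} are contained in exactly the
-- partitions obtained from an (r − t)-partition of the other n − t points by adding them.
-- Upper bound, by induction on n: if some r-partition contains 𝒯, the members of 𝒯 are
-- disjoint non-empty parts; pick an element i of one of them, U. If U = {i}, deleting the
-- part {i} is a bijection onto the (r − 1)-partitions of [n] ∖ {i} containing 𝒯 ∖ {U}.
-- Otherwise deleting i from its part is an injection into the r-partitions of [n] ∖ {i}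
-- containing 𝒯 with U replaced by U ∖ {i}, and s (n − 1 − t) (r − t) ≤ s (n − t) (r − t)
-- since adding a new point to a chosen part is injective (this needs r − t ≥ 1).

module Submission where

import Algebra.Properties.CommutativeSemigroup
open import Data.Bool using (Bool; true; false; T; not; _∧_; _∨_; if_then_else_; _≟_)
open import Data.Bool.ListAction using (all)
open import Data.Bool.Properties using (T-∧; T-∨; T-≡)
open import Data.Empty using (⊥-elim)
open import Data.Fin using (Fin; zero; suc; punchIn; punchOut)
open import Data.Fin.Properties using (punchIn-punchOut) renaming (_≟_ to _≟ᶠ_)
open import Data.Fin.Subset using (Subset; _∩_) renaming (⊥ to ∅)
open import Data.List
  using (List; []; _∷_; _++_; map; concatMap; filterᵇ; length; allFin; cartesianProduct)
open import Data.List.Membership.Propositional using (_∈_; find; lose)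
open import Data.List.Membership.Propositional.Properties
  using (∈-filter⁺; ∈-filter⁻; ∈-map⁺; ∈-map⁻; ∈-++⁺ˡ; ∈-++⁺ʳ; ∈-∃++; ∈-cartesianProduct⁺; ∈-allFin)
open import Data.List.Properties
  using (length-++; filter-++; filter-≐; filter-all; length-filter; foldr-preservesᵇ; foldr-preservesᵒ)
open import Data.List.Relation.Unary.All as All using ([]; _∷_)
open import Data.List.Relation.Unary.All.Properties as All using (all⁺; all⁻)
open import Data.List.Relation.Unary.AllPairs using (AllPairs; []; _∷_)
open import Data.List.Relation.Unary.Any using (here; there)
open import Data.List.Relation.Unary.Any.Properties using (any⁺; any⁻)
open import Data.List.Relation.Unary.Unique.Propositional using (Unique)
import Data.List.Relation.Unary.Unique.Propositional.Properties as Unique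
open import Data.Nat using (ℕ; zero; suc; _+_; _≤_; _<_; _∸_; _⊔_; _≡ᵇ_; z≤n; s≤s)
open import Data.Nat.Properties
  using ( +-commutativeSemigroup; +-suc; +-comm; suc-injective; ≤-refl; ≤-trans; ≤-antisym; <⇒≤
        ; ⊔-lub; m≤n⇒m≤n⊔o; m≤n⇒m≤o⊔n; ≡ᵇ⇒≡; ≡⇒≡ᵇ; module ≤-Reasoning)
open import Data.Product using (_×_; _,_; proj₁; proj₂; ∃-syntax)
open import Data.Sum as Sum using (_⊎_; inj₁; inj₂; [_,_])
open import Data.Vec using ([]; _∷_; lookup; insertAt; removeAt)
open import Data.Vec.Properties
  using ( ≡-dec; ∷-injectiveʳ; lookup-zipWith; lookup-replicate
        ; insertAt-lookup; insertAt-punchIn; removeAt-insertAt; insertAt-removeAt)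
open import Function using (_∘_; _⇔_; mk⇔)
open import Function.Bundles using (module Equivalence)
open import Relation.Binary.PropositionalEquality
  using (_≡_; _≢_; _≗_; refl; sym; trans; cong; cong₂; subst; subst₂; module ≡-Reasoning)
open import Relation.Nullary using (¬_)
open import Relation.Nullary.Decidable using (T?; Dec; does; yes; no; dec-true)

open import Defs

open Equivalence using (to; from)
open Algebra.Properties.CommutativeSemigroup +-commutativeSemigroup using (interchange)

private
  variable
    n k : ℕ

module _ {A B : Set} where

  length-≤-injection : ∀ (xs : List A) (ys : List B) (f : A → B) (g : B → A) → Unique xs →
    (∀ {x} → x ∈ xs → f x ∈ ys) → (∀ {x} → x ∈ xs → g (f x) ≡ x) → length xs ≤ length ys
  length-≤-injection [] ys f g _ _ _ = z≤n
  length-≤-injection (x ∷ xs) ys f g (x∉xs ∷ xs!) f∈ gf with ∈-∃++ (f∈ (here refl))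
  ... | ys₁ , ys₂ , refl = begin
    suc (length xs)               ≤⟨ s≤s (length-≤-injection xs (ys₁ ++ ys₂) f g xs! f∈′ (gf ∘ there)) ⟩
    suc (length (ys₁ ++ ys₂))     ≡⟨ cong suc (length-++ ys₁) ⟩
    suc (length ys₁ + length ys₂) ≡⟨ sym (+-suc (length ys₁) (length ys₂)) ⟩
    length ys₁ + length (f x ∷ ys₂) ≡⟨ sym (length-++ ys₁) ⟩
    length (ys₁ ++ f x ∷ ys₂)     ∎
    where
    open ≤-Reasoning
    fz≢fx : ∀ {z} → z ∈ xs → f z ≢ f x
    fz≢fx {z} z∈xs fz≡fx = All.lookup x∉xs z∈xs
      (trans (sym (gf (here refl))) (trans (cong g (sym fz≡fx)) (gf (there z∈xs))))
    remove : ∀ {v} (zs : List B) → v ∈ zs ++ f x ∷ ys₂ → v ≢ f x → v ∈ zs ++ ys₂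
    remove []       (here refl) v≢fx = ⊥-elim (v≢fx refl)
    remove []       (there v∈)  _    = v∈
    remove (_ ∷ zs) (here refl) _    = here refl
    remove (_ ∷ zs) (there v∈)  v≢fx = there (remove zs v∈ v≢fx)
    f∈′ : ∀ {z} → z ∈ xs → f z ∈ ys₁ ++ ys₂
    f∈′ z∈xs = remove ys₁ (f∈ (there z∈xs)) (fz≢fx z∈xs)

  concatMap-pairs≡cartesianProduct : ∀ (xs : List A) (ys : List B) →
    concatMap (λ x → map (x ,_) ys) xs ≡ cartesianProduct xs ys
  concatMap-pairs≡cartesianProduct []       ys = refl
  concatMap-pairs≡cartesianProduct (x ∷ xs) ys = cong (map (x ,_) ys ++_) (concatMap-pairs≡cartesianProduct xs ys)

module _ {A : Set} where

  length-filterᵇ-cong : ∀ {p q : A → Bool} → p ≗ q → ∀ xs → length (filterᵇ p xs) ≡ length (filterᵇ q xs)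
  length-filterᵇ-cong {p} {q} p≗q xs =
    cong length (filter-≐ (T? ∘ p) (T? ∘ q) ((λ {x} → subst T (p≗q x)) , (λ {x} → subst T (sym (p≗q x)))) xs)

  length-filterᵇ-map : ∀ {B : Set} (p : B → Bool) (f : A → B) xs →
    length (filterᵇ p (map f xs)) ≡ length (filterᵇ (p ∘ f) xs)
  length-filterᵇ-map p f []       = refl
  length-filterᵇ-map p f (x ∷ xs) with p (f x)
  ... | true  = cong suc (length-filterᵇ-map p f xs)
  ... | false = length-filterᵇ-map p f xs

  length-filterᵇ-∨ : ∀ (p q : A → Bool) → (∀ x → T (p x) → ¬ T (q x)) → ∀ xs →
    length (filterᵇ (λ x → p x ∨ q x) xs) ≡ length (filterᵇ p xs) + length (filterᵇ q xs)
  length-filterᵇ-∨ p q disjoint []       = refl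
  length-filterᵇ-∨ p q disjoint (x ∷ xs) with p x in px | q x in qx
  ... | true  | true  = ⊥-elim (disjoint x (subst T (sym px) _) (subst T (sym qx) _))
  ... | true  | false = cong suc (length-filterᵇ-∨ p q disjoint xs)
  ... | false | true  = trans (cong suc (length-filterᵇ-∨ p q disjoint xs)) (sym (+-suc _ _))
  ... | false | false = length-filterᵇ-∨ p q disjoint xs

T-not⇒¬T : ∀ {b} → T (not b) → ¬ T b
T-not⇒¬T {false} _ ()

¬T⇒T-not : ∀ {b} → ¬ T b → T (not b)
¬T⇒T-not {false} _   = _
¬T⇒T-not {true}  ¬tt = ¬tt _

T-⇔⇒≡ : ∀ {x y} → (T x → T y) → (T y → T x) → x ≡ y
T-⇔⇒≡ {false} {false} _ _ = refl
T-⇔⇒≡ {false} {true}  _ y⇒x = ⊥-elim (y⇒x _)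
T-⇔⇒≡ {true}  {false} x⇒y _ = ⊥-elim (x⇒y _)
T-⇔⇒≡ {true}  {true}  _ _ = refl

subsets-complete : (S : Subset n) → S ∈ subsets n
subsets-complete []          = here refl
subsets-complete {suc n} (false ∷ S) = ∈-++⁺ˡ (∈-map⁺ (false ∷_) (subsets-complete S))
subsets-complete {suc n} (true ∷ S)  = ∈-++⁺ʳ (map (false ∷_) (subsets n)) (∈-map⁺ (true ∷_) (subsets-complete S))

subsets-unique : ∀ n → Unique (subsets n)
subsets-unique zero    = [] ∷ []
subsets-unique (suc n) = Unique.++⁺ (Unique.map⁺ ∷-injectiveʳ (subsets-unique n))
                                    (Unique.map⁺ ∷-injectiveʳ (subsets-unique n)) false≢true
  where
  false≢true : ∀ {V} → ¬ (V ∈ map (false ∷_) (subsets n) × V ∈ map (true ∷_) (subsets n))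
  false≢true (V∈₀ , V∈₁) with ∈-map⁻ (false ∷_) V∈₀ | ∈-map⁻ (true ∷_) V∈₁
  ... | _ , _ , refl | _ , _ , ()

_≟ₛ_ : (S S′ : Subset n) → Dec (S ≡ S′)
_≟ₛ_ = ≡-dec _≟_

_==_ : Subset n → Subset n → Bool
S == S′ = does (S ≟ₛ S′)

==-refl : (S : Subset n) → T (S == S)
==-refl S = subst T (sym (dec-true (S ≟ₛ S) refl)) _

==-sound : (S S′ : Subset n) → T (S == S′) → S ≡ S′
==-sound S S′ S==S′ with S ≟ₛ S′
... | yes S≡S′ = S≡S′

∉∅ : (j : Fin n) → ¬ T (lookup ∅ j)
∉∅ j = subst T (lookup-replicate j false)

NonEmpty : Subset n → Set
NonEmpty {n} S = ∃[ j ] T (lookup S j)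

Overlap : Subset n → Subset n → Set
Overlap {n} S S′ = ∃[ j ] T (lookup S j) × T (lookup S′ j)

Overlap-sym : {S S′ : Subset n} → Overlap S S′ → Overlap S′ S
Overlap-sym (j , j∈S , j∈S′) = j , j∈S′ , j∈S

¬Overlap-∅ : (S : Subset n) → ¬ Overlap ∅ S
¬Overlap-∅ S (j , j∈∅ , _) = ∉∅ j j∈∅

nonemptyᵇ⇒NonEmpty : (S : Subset n) → T (nonemptyᵇ S) → NonEmpty S
nonemptyᵇ⇒NonEmpty (true ∷ S)  _ = zero , _
nonemptyᵇ⇒NonEmpty (false ∷ S) t with j , j∈S ← nonemptyᵇ⇒NonEmpty S t = suc j , j∈S

NonEmpty⇒nonemptyᵇ : (S : Subset n) → NonEmpty S → T (nonemptyᵇ S)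
NonEmpty⇒nonemptyᵇ (true ∷ S)  _              = _
NonEmpty⇒nonemptyᵇ (false ∷ S) (suc j , j∈S) = NonEmpty⇒nonemptyᵇ S (j , j∈S)

¬nonemptyᵇ⇒≡∅ : (S : Subset n) → ¬ T (nonemptyᵇ S) → S ≡ ∅
¬nonemptyᵇ⇒≡∅ []          _     = refl
¬nonemptyᵇ⇒≡∅ (true ∷ S)  empty = ⊥-elim (empty _)
¬nonemptyᵇ⇒≡∅ (false ∷ S) empty = cong (false ∷_) (¬nonemptyᵇ⇒≡∅ S empty)

NonEmpty-∩⇔Overlap : (S S′ : Subset n) → NonEmpty (S ∩ S′) ⇔ Overlap S S′
NonEmpty-∩⇔Overlap S S′ = mk⇔
  (λ (j , j∈S∩S′) → j , to T-∧ (subst T (lookup-zipWith _∧_ j S S′) j∈S∩S′))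
  (λ (j , j∈S , j∈S′) → j , subst T (sym (lookup-zipWith _∧_ j S S′)) (from T-∧ (j∈S , j∈S′)))

disjointᵇ⇒¬Overlap : (S S′ : Subset n) → T (disjointᵇ S S′) → ¬ Overlap S S′
disjointᵇ⇒¬Overlap S S′ t common =
  T-not⇒¬T t (NonEmpty⇒nonemptyᵇ (S ∩ S′) (from (NonEmpty-∩⇔Overlap S S′) common))

¬Overlap⇒disjointᵇ : (S S′ : Subset n) → ¬ Overlap S S′ → T (disjointᵇ S S′)
¬Overlap⇒disjointᵇ S S′ ¬common =
  ¬T⇒T-not (¬common ∘ to (NonEmpty-∩⇔Overlap S S′) ∘ nonemptyᵇ⇒NonEmpty (S ∩ S′))

Predᵇ : ℕ → Set
Predᵇ n = Subset n → Bool

_⊆ᵇ_ : Predᵇ n → Predᵇ n → Set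
p ⊆ᵇ q = ∀ S → T (p S) → T (q S)

count : Predᵇ n → ℕ
count {n} p = length (filterᵇ p (subsets n))

count-cong : {p q : Predᵇ n} → p ≗ q → count p ≡ count q
count-cong {n} p≗q = length-filterᵇ-cong p≗q (subsets n)

count-∨ : (p q : Predᵇ n) → (∀ S → T (p S) → ¬ T (q S)) → count (λ S → p S ∨ q S) ≡ count p + count q
count-∨ {n} p q disjoint = length-filterᵇ-∨ p q disjoint (subsets n)

count-false : count {n} (λ _ → false) ≡ 0
count-false {n} = go (subsets n)
  where
  go : (Ss : List (Subset n)) → length (filterᵇ (λ _ → false) Ss) ≡ 0
  go []       = refl
  go (_ ∷ Ss) = go Ss

count-head : (p : Predᵇ (suc n)) → count p ≡ count (p ∘ (false ∷_)) + count (p ∘ (true ∷_))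
count-head {n} p = begin
  length (filterᵇ p (map (false ∷_) (subsets n) ++ map (true ∷_) (subsets n)))
    ≡⟨ cong length (filter-++ (T? ∘ p) (map (false ∷_) (subsets n)) _) ⟩
  length (filterᵇ p (map (false ∷_) (subsets n)) ++ filterᵇ p (map (true ∷_) (subsets n)))
    ≡⟨ length-++ (filterᵇ p (map (false ∷_) (subsets n))) ⟩
  length (filterᵇ p (map (false ∷_) (subsets n))) + length (filterᵇ p (map (true ∷_) (subsets n)))
    ≡⟨ cong₂ _+_ (length-filterᵇ-map p (false ∷_) (subsets n)) (length-filterᵇ-map p (true ∷_) (subsets n)) ⟩
  count (p ∘ (false ∷_)) + count (p ∘ (true ∷_)) ∎
  where open ≡-Reasoning

count-== : (S : Subset n) → count (S ==_) ≡ 1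
count-== []          = refl
count-== {suc n} (false ∷ S) = trans (count-head ((false ∷ S) ==_))
                                     (cong₂ _+_ (count-== S) (count-false {n = n}))
count-== {suc n} (true ∷ S)  = trans (count-head ((true ∷ S) ==_))
                                     (cong₂ _+_ (count-false {n = n}) (count-== S))

count-insertAt : (i : Fin (suc n)) (p : Predᵇ (suc n)) →
  count p ≡ count (λ R → p (insertAt R i false)) + count (λ R → p (insertAt R i true))
count-insertAt zero            p = count-head p
count-insertAt {suc n} (suc i) p = begin
  count p
    ≡⟨ count-head p ⟩
  count (p ∘ (false ∷_)) + count (p ∘ (true ∷_))
    ≡⟨ cong₂ _+_ (count-insertAt i (p ∘ (false ∷_))) (count-insertAt i (p ∘ (true ∷_))) ⟩
  (c false false + c false true) + (c true false + c true true)
    ≡⟨ interchange (c false false) (c false true) (c true false) (c true true) ⟩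
  (c false false + c true false) + (c false true + c true true)
    ≡⟨ sym (cong₂ _+_ (count-head (λ V → p (insertAt V (suc i) false)))
                      (count-head (λ V → p (insertAt V (suc i) true)))) ⟩
  count (λ V → p (insertAt V (suc i) false)) + count (λ V → p (insertAt V (suc i) true)) ∎
  where
  open ≡-Reasoning
  c : Bool → Bool → ℕ
  c b b′ = count (λ R → p (b ∷ insertAt R i b′))

_∖_ : Predᵇ n → Subset n → Predᵇ n
(q ∖ S′) R = q R ∧ not (S′ == R)

∖-absent : (q : Predᵇ n) {S′ : Subset n} → ¬ T (q S′) → q ∖ S′ ≗ q
∖-absent q {S′} ¬qS′ R = T-⇔⇒≡ (proj₁ ∘ to (T-∧ {q R}))
  (λ qR → from T-∧ (qR , ¬T⇒T-not (λ S′==R → ¬qS′ (subst (T ∘ q) (sym (==-sound S′ R S′==R)) qR))))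

∖-∨ : (q : Predᵇ n) {S′ : Subset n} → T (q S′) → (λ R → (q ∖ S′) R ∨ (S′ == R)) ≗ q
∖-∨ q {S′} qS′ R = T-⇔⇒≡
  (λ t → [ proj₁ ∘ to (T-∧ {q R}) , (λ S′==R → subst (T ∘ q) (==-sound S′ R S′==R) qS′) ]
            (to (T-∨ {(q ∖ S′) R}) t))
  backward
  where
  backward : T (q R) → T ((q ∖ S′) R ∨ (S′ == R))
  backward qR with T? (S′ == R)
  ... | yes S′==R = from T-∨ (inj₂ S′==R)
  ... | no ¬S′==R = from T-∨ (inj₁ (from T-∧ (qR , ¬T⇒T-not ¬S′==R)))

∨-∖ : (a : Predᵇ n) {S′ : Subset n} → ¬ T (a S′) → (λ R → a R ∨ (S′ == R)) ∖ S′ ≗ a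
∨-∖ a {S′} ¬aS′ R = T-⇔⇒≡ forward
  (λ aR → from T-∧ (from T-∨ (inj₁ aR) , ¬T⇒T-not (λ S′==R → ¬aS′ (subst (T ∘ a) (sym (==-sound S′ R S′==R)) aR))))
  where
  forward : T ((a R ∨ (S′ == R)) ∧ not (S′ == R)) → T (a R)
  forward t with t∨ , t¬ ← to (T-∧ {a R ∨ (S′ == R)}) t =
    [ (λ aR → aR) , (λ S′==R → ⊥-elim (T-not⇒¬T t¬ S′==R)) ] (to (T-∨ {a R}) t∨)

⟦_⟧ : SetSys n → Predᵇ n
⟦ X ⟧ S = S ∈ₛ X

tabulateₛ : Predᵇ n → SetSys n
tabulateₛ {zero}  p = p []
tabulateₛ {suc n} p = tabulateₛ (p ∘ (false ∷_)) , tabulateₛ (p ∘ (true ∷_))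

⟦⟧-tabulateₛ : (p : Predᵇ n) → ⟦ tabulateₛ p ⟧ ≗ p
⟦⟧-tabulateₛ p []          = refl
⟦⟧-tabulateₛ p (false ∷ S) = ⟦⟧-tabulateₛ (p ∘ (false ∷_)) S
⟦⟧-tabulateₛ p (true ∷ S)  = ⟦⟧-tabulateₛ (p ∘ (true ∷_)) S

∈-tabulateₛ⁺ : (p : Predᵇ n) {S : Subset n} → T (p S) → T (⟦ tabulateₛ p ⟧ S)
∈-tabulateₛ⁺ p {S} = subst T (sym (⟦⟧-tabulateₛ p S))

∈-tabulateₛ⁻ : (p : Predᵇ n) {S : Subset n} → T (⟦ tabulateₛ p ⟧ S) → T (p S)
∈-tabulateₛ⁻ p {S} = subst T (⟦⟧-tabulateₛ p S)

SetSys-ext : {X Y : SetSys n} → ⟦ X ⟧ ≗ ⟦ Y ⟧ → X ≡ Y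
SetSys-ext {zero}            X≗Y = X≗Y []
SetSys-ext {suc n} {A , B} {A′ , B′} X≗Y =
  cong₂ _,_ (SetSys-ext (X≗Y ∘ (false ∷_))) (SetSys-ext (X≗Y ∘ (true ∷_)))

allSetSys-complete : (X : SetSys n) → X ∈ allSetSys n
allSetSys-complete {zero}  true    = here refl
allSetSys-complete {zero}  false   = there (here refl)
allSetSys-complete {suc n} (A , B) =
  subst ((A , B) ∈_) (sym (concatMap-pairs≡cartesianProduct (allSetSys n) (allSetSys n)))
    (∈-cartesianProduct⁺ (allSetSys-complete A) (allSetSys-complete B))

allSetSys-unique : ∀ n → Unique (allSetSys n)
allSetSys-unique zero    = ((λ ()) ∷ []) ∷ [] ∷ []
allSetSys-unique (suc n) =
  subst Unique (sym (concatMap-pairs≡cartesianProduct (allSetSys n) (allSetSys n)))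
    (Unique.cartesianProduct⁺ (allSetSys-unique n) (allSetSys-unique n))

∈-members⁻ : (X : SetSys n) {S : Subset n} → S ∈ members X → T (⟦ X ⟧ S)
∈-members⁻ {n} X S∈ = proj₂ (∈-filter⁻ (T? ∘ ⟦ X ⟧) {xs = subsets n} S∈)

∈-members⁺ : (X : SetSys n) {S : Subset n} → T (⟦ X ⟧ S) → S ∈ members X
∈-members⁺ {n} X {S} S∈X = ∈-filter⁺ (T? ∘ ⟦ X ⟧) (subsets-complete S) S∈X

members-unique : (X : SetSys n) → Unique (members X)
members-unique {n} X = Unique.filter⁺ (T? ∘ ⟦ X ⟧) (subsets-unique n)

size-tabulateₛ : (p : Predᵇ n) → size (tabulateₛ p) ≡ count p
size-tabulateₛ p = count-cong (⟦⟧-tabulateₛ p)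

∅ₛ : SetSys n
∅ₛ = tabulateₛ (λ _ → false)

∉∅ₛ : (S : Subset n) → ¬ T (⟦ ∅ₛ ⟧ S)
∉∅ₛ {n} S = ∈-tabulateₛ⁻ {n} (λ _ → false)

size-∅ₛ : size (∅ₛ {n}) ≡ 0
size-∅ₛ {n} = trans (size-tabulateₛ {n} (λ _ → false)) (count-false {n = n})

-- Partitions

record IsPartition (p : Predᵇ n) : Set where
  field
    nonEmpty : ∀ {S} → T (p S) → NonEmpty S
    disjoint : ∀ {S S′} → T (p S) → T (p S′) → Overlap S S′ → S ≡ S′
    covers   : ∀ j → ∃[ S ] T (p S) × T (lookup S j)

open IsPartition

IsPartition-cong : {p q : Predᵇ n} → p ≗ q → IsPartition p → IsPartition q
IsPartition-cong p≗q P = record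
  { nonEmpty = λ {S} qS → nonEmpty P (subst T (sym (p≗q S)) qS)
  ; disjoint = λ {S} {S′} qS qS′ → disjoint P (subst T (sym (p≗q S)) qS) (subst T (sym (p≗q S′)) qS′)
  ; covers   = λ j → let S , pS , j∈S = covers P j in S , subst T (p≗q S) pS , j∈S
  }

∅-not-part : {q : Predᵇ n} → IsPartition q → ¬ T (q ∅)
∅-not-part Q q∅ with j , j∈∅ ← nonEmpty Q q∅ = ∉∅ j j∈∅

Disjointᵇ : Subset n → Subset n → Set
Disjointᵇ S S′ = T (disjointᵇ S S′)

pairwiseDisjointᵇ⇒AllPairs : (Ss : List (Subset n)) → T (pairwiseDisjointᵇ Ss) → AllPairs Disjointᵇ Ss
pairwiseDisjointᵇ⇒AllPairs []       _ = []
pairwiseDisjointᵇ⇒AllPairs (S ∷ Ss) t with t₁ , t₂ ← to T-∧ t =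
  all⁺ (disjointᵇ S) Ss t₁ ∷ pairwiseDisjointᵇ⇒AllPairs Ss t₂

AllPairs⇒pairwiseDisjointᵇ : (Ss : List (Subset n)) → AllPairs Disjointᵇ Ss → T (pairwiseDisjointᵇ Ss)
AllPairs⇒pairwiseDisjointᵇ []       _             = _
AllPairs⇒pairwiseDisjointᵇ (S ∷ Ss) (S#Ss ∷ Ss#) =
  from T-∧ (all⁻ (disjointᵇ S) S#Ss , AllPairs⇒pairwiseDisjointᵇ Ss Ss#)

AllPairs-Disjointᵇ⇒≡ : {Ss : List (Subset n)} → AllPairs Disjointᵇ Ss →
  ∀ {S S′} → S ∈ Ss → S′ ∈ Ss → Overlap S S′ → S ≡ S′
AllPairs-Disjointᵇ⇒≡ (_ ∷ _)        (here refl) (here refl)  _      = refl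
AllPairs-Disjointᵇ⇒≡ (S₀#Ss ∷ _) {S} {S′} (here refl) (there S′∈) common =
  ⊥-elim (disjointᵇ⇒¬Overlap S S′ (All.lookup S₀#Ss S′∈) common)
AllPairs-Disjointᵇ⇒≡ (S₀#Ss ∷ _) {S} {S′} (there S∈) (here refl) common =
  ⊥-elim (disjointᵇ⇒¬Overlap S′ S (All.lookup S₀#Ss S∈) (Overlap-sym {S = S} {S′} common))
AllPairs-Disjointᵇ⇒≡ (_ ∷ Ss#)    (there S∈) (there S′∈) common = AllPairs-Disjointᵇ⇒≡ Ss# S∈ S′∈ common

≡⇒AllPairs-Disjointᵇ : {Ss : List (Subset n)} → Unique Ss →
  (∀ {S S′} → S ∈ Ss → S′ ∈ Ss → Overlap S S′ → S ≡ S′) → AllPairs Disjointᵇ Ss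
≡⇒AllPairs-Disjointᵇ {Ss = []}     []              _       = []
≡⇒AllPairs-Disjointᵇ {Ss = S ∷ Ss} (S∉Ss ∷ Ss!) overlap⇒≡ =
  All.tabulate S#
    ∷ ≡⇒AllPairs-Disjointᵇ Ss! (λ S∈ S′∈ → overlap⇒≡ (there S∈) (there S′∈))
  where
  S# : ∀ {S′} → S′ ∈ Ss → Disjointᵇ S S′
  S# S′∈ = ¬Overlap⇒disjointᵇ S _ (All.lookup S∉Ss S′∈ ∘ overlap⇒≡ (here refl) (there S′∈))

isPartitionᵇ⇒IsPartition : (r : ℕ) (X : SetSys n) → T (isPartitionᵇ r X) → IsPartition ⟦ X ⟧ × size X ≡ r
isPartitionᵇ⇒IsPartition {n} r X t
  with t-nonEmpty , t′ ← to T-∧ t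
  with t-disjoint , t″ ← to T-∧ t′
  with t-covers , t-size ← to T-∧ t″ = partition , ≡ᵇ⇒≡ (size X) r t-size
  where
  partition : IsPartition ⟦ X ⟧
  partition .nonEmpty {S} S∈X =
    nonemptyᵇ⇒NonEmpty S (All.lookup (all⁺ nonemptyᵇ (members X) t-nonEmpty) (∈-members⁺ X S∈X))
  partition .disjoint S∈X S′∈X = AllPairs-Disjointᵇ⇒≡
    (pairwiseDisjointᵇ⇒AllPairs (members X) t-disjoint) (∈-members⁺ X S∈X) (∈-members⁺ X S′∈X)
  partition .covers j
    with S , S∈ , j∈S ← find (any⁻ (λ S → lookup S j) (members X)
                             (All.lookup (all⁺ _ (allFin n) t-covers) (∈-allFin j)))
    = S , ∈-members⁻ X S∈ , j∈S

IsPartition⇒isPartitionᵇ : (r : ℕ) (X : SetSys n) → IsPartition ⟦ X ⟧ → size X ≡ r → T (isPartitionᵇ r X)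
IsPartition⇒isPartitionᵇ {n} r X P size≡r = from T-∧ (t-nonEmpty ,
  from T-∧ (t-disjoint , from T-∧ (t-covers , ≡⇒≡ᵇ (size X) r size≡r)))
  where
  t-nonEmpty : T (all nonemptyᵇ (members X))
  t-nonEmpty = all⁻ nonemptyᵇ (All.tabulate λ {S} S∈ → NonEmpty⇒nonemptyᵇ S (nonEmpty P (∈-members⁻ X S∈)))
  t-disjoint : T (pairwiseDisjointᵇ (members X))
  t-disjoint = AllPairs⇒pairwiseDisjointᵇ (members X) (≡⇒AllPairs-Disjointᵇ (members-unique X)
    λ S∈ S′∈ → disjoint P (∈-members⁻ X S∈) (∈-members⁻ X S′∈))
  t-covers : T (coversᵇ (members X))
  t-covers = all⁻ _ {xs = allFin n} (All.tabulate λ {j} _ →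
    let S , S∈X , j∈S = covers P j in any⁺ (λ S → lookup S j) (lose (∈-members⁺ X S∈X) j∈S))

⊆ₛ⇒⊆ᵇ : (𝒯 X : SetSys n) → T (𝒯 ⊆ₛ X) → ⟦ 𝒯 ⟧ ⊆ᵇ ⟦ X ⟧
⊆ₛ⇒⊆ᵇ 𝒯 X t S S∈𝒯 = All.lookup (all⁺ (_∈ₛ X) (members 𝒯) t) (∈-members⁺ 𝒯 S∈𝒯)

⊆ᵇ⇒⊆ₛ : (𝒯 X : SetSys n) → ⟦ 𝒯 ⟧ ⊆ᵇ ⟦ X ⟧ → T (𝒯 ⊆ₛ X)
⊆ᵇ⇒⊆ₛ 𝒯 X 𝒯⊆X = all⁻ (_∈ₛ X) (All.tabulate λ {S} → 𝒯⊆X S ∘ ∈-members⁻ 𝒯)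

record PartitionContaining (r : ℕ) (𝒯 X : SetSys n) : Set where
  field
    isPartition : IsPartition ⟦ X ⟧
    size≡       : size X ≡ r
    contains    : ⟦ 𝒯 ⟧ ⊆ᵇ ⟦ X ⟧

open PartitionContaining

∈-P[]⁻ : ∀ {r} (𝒯 X : SetSys n) → X ∈ P n r [ 𝒯 ] → PartitionContaining r 𝒯 X
∈-P[]⁻ {n} {r} 𝒯 X X∈
  with X∈P , 𝒯⊆X ← ∈-filter⁻ (T? ∘ (𝒯 ⊆ₛ_)) {xs = P n r} X∈
  with isPartition , size≡r ←
         isPartitionᵇ⇒IsPartition r X (proj₂ (∈-filter⁻ (T? ∘ isPartitionᵇ r) {xs = allSetSys n} X∈P))
  = record { isPartition = isPartition ; size≡ = size≡r ; contains = ⊆ₛ⇒⊆ᵇ 𝒯 X 𝒯⊆X }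

∈-P[]⁺ : ∀ {r} (𝒯 X : SetSys n) → PartitionContaining r 𝒯 X → X ∈ P n r [ 𝒯 ]
∈-P[]⁺ {n} {r} 𝒯 X X∈ = ∈-filter⁺ (T? ∘ (𝒯 ⊆ₛ_))
  (∈-filter⁺ (T? ∘ isPartitionᵇ r) (allSetSys-complete X)
    (IsPartition⇒isPartitionᵇ r X (isPartition X∈) (size≡ X∈)))
  (⊆ᵇ⇒⊆ₛ 𝒯 X (contains X∈))

P[]-unique : ∀ r (𝒯 : SetSys n) → Unique (P n r [ 𝒯 ])
P[]-unique {n} r 𝒯 = Unique.filter⁺ (T? ∘ (𝒯 ⊆ₛ_)) (Unique.filter⁺ (T? ∘ isPartitionᵇ r) (allSetSys-unique n))

#P : (n r : ℕ) → SetSys n → ℕ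
#P n r 𝒯 = length (P n r [ 𝒯 ])

#P-≤ : ∀ {m r r′} {𝒯 : SetSys n} {𝒯′ : SetSys m} (f : SetSys n → SetSys m) (g : SetSys m → SetSys n) →
  (∀ {X} → PartitionContaining r 𝒯 X → PartitionContaining r′ 𝒯′ (f X)) →
  (∀ {X} → PartitionContaining r 𝒯 X → g (f X) ≡ X) →
  #P n r 𝒯 ≤ #P m r′ 𝒯′
#P-≤ {r = r} {𝒯 = 𝒯} {𝒯′} f g f-maps g∘f≡id = length-≤-injection _ _ f g (P[]-unique r 𝒯)
  (λ {X} X∈ → ∈-P[]⁺ 𝒯′ (f X) (f-maps (∈-P[]⁻ 𝒯 X X∈)))
  (λ {X} X∈ → g∘f≡id (∈-P[]⁻ 𝒯 X X∈))

#P-≡ : ∀ {m r r′} {𝒯 : SetSys n} {𝒯′ : SetSys m} (f : SetSys n → SetSys m) (g : SetSys m → SetSys n) →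
  (∀ {X} → PartitionContaining r 𝒯 X → PartitionContaining r′ 𝒯′ (f X)) →
  (∀ {X} → PartitionContaining r′ 𝒯′ X → PartitionContaining r 𝒯 (g X)) →
  (∀ {X} → PartitionContaining r 𝒯 X → g (f X) ≡ X) →
  (∀ {X} → PartitionContaining r′ 𝒯′ X → f (g X) ≡ X) →
  #P n r 𝒯 ≡ #P m r′ 𝒯′
#P-≡ f g f-maps g-maps g∘f≡id f∘g≡id = ≤-antisym (#P-≤ f g f-maps g∘f≡id) (#P-≤ g f g-maps f∘g≡id)

#P-∅ₛ : ∀ n r → #P n r ∅ₛ ≡ s n r
#P-∅ₛ n r = cong length (filter-all (T? ∘ (∅ₛ ⊆ₛ_)) {xs = P n r}
  (All.tabulate λ {X} _ → ⊆ᵇ⇒⊆ₛ ∅ₛ X λ S → ⊥-elim ∘ ∉∅ₛ S))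

#P≤s : ∀ n r (𝒯 : SetSys n) → #P n r 𝒯 ≤ s n r
#P≤s n r 𝒯 = length-filter (T? ∘ (𝒯 ⊆ₛ_)) (P n r)

-- Removing one element i of [n + 1]

-- For a set system p on [n + 1], avoiding p R says that R is a member not containing i
-- and through p R that R ∪ {i} is a member; merge reassembles p from these two sections.
module Coordinate {n : ℕ} (i : Fin (suc n)) where

  avoiding : Predᵇ (suc n) → Predᵇ n
  avoiding p R = p (insertAt R i false)

  through : Predᵇ (suc n) → Predᵇ n
  through p R = p (insertAt R i true)

  merge : Predᵇ n → Predᵇ n → Predᵇ (suc n)
  merge a b V = if lookup V i then b (removeAt V i) else a (removeAt V i)

  avoiding-merge : (a b : Predᵇ n) → avoiding (merge a b) ≗ a
  avoiding-merge a b R rewrite insertAt-lookup R i false | removeAt-insertAt R i false = refl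

  through-merge : (a b : Predᵇ n) → through (merge a b) ≗ b
  through-merge a b R rewrite insertAt-lookup R i true | removeAt-insertAt R i true = refl

  data Split : Subset (suc n) → Set where
    split : (R : Subset n) (c : Bool) → Split (insertAt R i c)

  splitAt : (V : Subset (suc n)) → Split V
  splitAt V = subst Split (insertAt-removeAt V i) (split (removeAt V i) (lookup V i))

  merge-sections : (p : Predᵇ (suc n)) → merge (avoiding p) (through p) ≗ p
  merge-sections p V with splitAt V
  ... | split R false = avoiding-merge (avoiding p) (through p) R
  ... | split R true  = through-merge (avoiding p) (through p) R

  merge-cong : {a a′ b b′ : Predᵇ n} → a ≗ a′ → b ≗ b′ → merge a b ≗ merge a′ b′
  merge-cong a≗a′ b≗b′ V with lookup V i
  ... | false = a≗a′ (removeAt V i)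
  ... | true  = b≗b′ (removeAt V i)

  coordinate : (k : Fin (suc n)) → k ≡ i ⊎ ∃[ j ] k ≡ punchIn i j
  coordinate k with i ≟ᶠ k
  ... | yes refl = inj₁ refl
  ... | no  i≢k  = inj₂ (punchOut i≢k , sym (punchIn-punchOut i≢k))

  insertAt-injective : ∀ {R R′ : Subset n} {c c′} → insertAt R i c ≡ insertAt R′ i c′ → R ≡ R′ × c ≡ c′
  insertAt-injective {R} {R′} {c} {c′} eq =
    trans (sym (removeAt-insertAt R i c)) (trans (cong (λ V → removeAt V i) eq) (removeAt-insertAt R′ i c′)) ,
    trans (sym (insertAt-lookup R i c)) (trans (cong (λ V → lookup V i) eq) (insertAt-lookup R′ i c′))

  ∈-insertAt-punchIn : ∀ R c j → T (lookup (insertAt R i c) (punchIn i j)) → T (lookup R j)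
  ∈-insertAt-punchIn R c j = subst T (insertAt-punchIn R i c j)

  ∈-insertAt-punchIn⁺ : ∀ R c j → T (lookup R j) → T (lookup (insertAt R i c) (punchIn i j))
  ∈-insertAt-punchIn⁺ R c j = subst T (sym (insertAt-punchIn R i c j))

  i∈insertAt-true : ∀ R → T (lookup (insertAt R i true) i)
  i∈insertAt-true R = subst T (sym (insertAt-lookup R i true)) _

  NonEmpty-insertAt⁺ : ∀ {R : Subset n} c → NonEmpty R → NonEmpty (insertAt R i c)
  NonEmpty-insertAt⁺ {R} c (j , j∈R) = punchIn i j , ∈-insertAt-punchIn⁺ R c j j∈R

  NonEmpty-insertAt-true : ∀ R → NonEmpty (insertAt R i true)
  NonEmpty-insertAt-true R = i , i∈insertAt-true R

  NonEmpty-insertAt-false⁻ : ∀ {R : Subset n} → NonEmpty (insertAt R i false) → NonEmpty R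
  NonEmpty-insertAt-false⁻ {R} (k , k∈) with coordinate k
  ... | inj₁ refl       = ⊥-elim (subst T (insertAt-lookup R i false) k∈)
  ... | inj₂ (j , refl) = j , ∈-insertAt-punchIn R false j k∈

  Overlap-insertAt⁺ : ∀ {R R′ : Subset n} c c′ → Overlap R R′ → Overlap (insertAt R i c) (insertAt R′ i c′)
  Overlap-insertAt⁺ {R} {R′} c c′ (j , j∈R , j∈R′) =
    punchIn i j , ∈-insertAt-punchIn⁺ R c j j∈R , ∈-insertAt-punchIn⁺ R′ c′ j j∈R′

  Overlap-insertAt-true : ∀ R R′ → Overlap (insertAt R i true) (insertAt R′ i true)
  Overlap-insertAt-true R R′ = i , i∈insertAt-true R , i∈insertAt-true R′

  Overlap-insertAt⁻ : ∀ {R R′ : Subset n} {c c′} → Overlap (insertAt R i c) (insertAt R′ i c′) →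
    (T c × T c′) ⊎ Overlap R R′
  Overlap-insertAt⁻ {R} {R′} {c} {c′} (k , k∈V , k∈V′) with coordinate k
  ... | inj₁ refl       = inj₁ (subst T (insertAt-lookup R i c) k∈V , subst T (insertAt-lookup R′ i c′) k∈V′)
  ... | inj₂ (j , refl) = inj₂ (j , ∈-insertAt-punchIn R c j k∈V , ∈-insertAt-punchIn R′ c′ j k∈V′)

  through-block : {p q : Predᵇ (suc n)} {S′ : Subset n} → IsPartition q → p ⊆ᵇ q →
    T (p (insertAt S′ i true)) → through p ≗ (S′ ==_)
  through-block {p} {q} {S′} Q p⊆q pS′ R = T-⇔⇒≡ forward backward
    where
    forward : T (p (insertAt R i true)) → T (S′ == R)
    forward pR = subst (T ∘ (S′ ==_))
      (proj₁ (insertAt-injective (disjoint Q (p⊆q _ pS′) (p⊆q _ pR) (Overlap-insertAt-true S′ R)))) (==-refl S′)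
    backward : T (S′ == R) → T (p (insertAt R i true))
    backward S′==R = subst (λ Z → T (p (insertAt Z i true))) (==-sound S′ R S′==R) pS′

  avoiding-through-apart : {q : Predᵇ (suc n)} {R R′ : Subset n} → IsPartition q →
    T (avoiding q R) → T (through q R′) → ¬ Overlap R R′
  avoiding-through-apart {R = R} {R′} Q qR qR′ common
    with () ← proj₂ (insertAt-injective {R} {R′} (disjoint Q qR qR′ (Overlap-insertAt⁺ false true common)))

  avoiding-block : {q : Predᵇ (suc n)} {S′ : Subset n} → IsPartition q → T (through q S′) → ¬ T (avoiding q S′)
  avoiding-block {S′ = S′} Q qS′ q₀S′ with j , j∈S′ ← NonEmpty-insertAt-false⁻ (nonEmpty Q q₀S′) =
    avoiding-through-apart Q q₀S′ qS′ (j , j∈S′ , j∈S′)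

  IsPartition-avoiding : {p : Predᵇ (suc n)} → IsPartition p → T (p (insertAt ∅ i true)) →
    IsPartition (avoiding p)
  IsPartition-avoiding {p} P p∅ = record
    { nonEmpty = NonEmpty-insertAt-false⁻ ∘ nonEmpty P
    ; disjoint = λ pR pR′ common →
        proj₁ (insertAt-injective (disjoint P pR pR′ (Overlap-insertAt⁺ false false common)))
    ; covers   = covers′
    }
    where
    covers′ : ∀ j → ∃[ R ] T (avoiding p R) × T (lookup R j)
    covers′ j with covers P (punchIn i j)
    ... | V , pV , j∈V with splitAt V
    ... | split R false = R , pV , ∈-insertAt-punchIn R false j j∈V
    ... | split R true  = ⊥-elim (∉∅ j (subst (λ Z → T (lookup Z j)) (sym ∅≡R) (∈-insertAt-punchIn R true j j∈V)))
      where
      ∅≡R : ∅ ≡ R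
      ∅≡R = ==-sound ∅ R (subst T (through-block {p} {p} P (λ _ pS → pS) p∅ R) pV)

  IsPartition-deleteElement : {p : Predᵇ (suc n)} → IsPartition p → ¬ T (p (insertAt ∅ i true)) →
    IsPartition (λ R → avoiding p R ∨ through p R)
  IsPartition-deleteElement {p} P ¬p∅ = record { nonEmpty = nonEmpty′ ; disjoint = disjoint′ ; covers = covers′ }
    where
    nonEmpty′ : ∀ {R} → T (avoiding p R ∨ through p R) → NonEmpty R
    nonEmpty′ {R} t with to (T-∨ {avoiding p R}) t | T? (nonemptyᵇ R)
    ... | inj₁ pR | _         = NonEmpty-insertAt-false⁻ (nonEmpty P pR)
    ... | inj₂ _  | yes R≠∅   = nonemptyᵇ⇒NonEmpty R R≠∅
    ... | inj₂ pR | no ¬R≠∅   = ⊥-elim (¬p∅ (subst (λ Z → T (through p Z)) (¬nonemptyᵇ⇒≡∅ R ¬R≠∅) pR))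
    disjoint′ : ∀ {R R′} → T (avoiding p R ∨ through p R) → T (avoiding p R′ ∨ through p R′) →
      Overlap R R′ → R ≡ R′
    disjoint′ {R} {R′} t t′ common with to (T-∨ {avoiding p R}) t | to (T-∨ {avoiding p R′}) t′
    ... | inj₁ pR | inj₁ pR′ = proj₁ (insertAt-injective (disjoint P pR pR′ (Overlap-insertAt⁺ false false common)))
    ... | inj₁ pR | inj₂ pR′ = ⊥-elim (avoiding-through-apart P pR pR′ common)
    ... | inj₂ pR | inj₁ pR′ = ⊥-elim (avoiding-through-apart P pR′ pR (Overlap-sym {S = R} {R′} common))
    ... | inj₂ pR | inj₂ pR′ = proj₁ (insertAt-injective (disjoint P pR pR′ (Overlap-insertAt-true R R′)))
    covers′ : ∀ j → ∃[ R ] T (avoiding p R ∨ through p R) × T (lookup R j)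
    covers′ j with covers P (punchIn i j)
    ... | V , pV , j∈V with splitAt V
    ... | split R false = R , from T-∨ (inj₁ pV) , ∈-insertAt-punchIn R false j j∈V
    ... | split R true  = R , from T-∨ (inj₂ pV) , ∈-insertAt-punchIn R true j j∈V

  IsPartition-merge : {q : Predᵇ n} {S′ : Subset n} → IsPartition q → T (q S′) ⊎ S′ ≡ ∅ →
    IsPartition (merge (q ∖ S′) (S′ ==_))
  IsPartition-merge {q} {S′} Q S′-allowed = record
    { nonEmpty = λ {V} → nonEmpty′ {V} ; disjoint = λ {V} {V′} → disjoint′ {V} {V′} ; covers = covers′ }
    where
    m : Predᵇ (suc n)
    m = merge (q ∖ S′) (S′ ==_)
    m-avoiding : ∀ R → T (m (insertAt R i false)) → T (q R) × ¬ T (S′ == R)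
    m-avoiding R t with qR , t¬ ← to (T-∧ {q R}) (subst T (avoiding-merge (q ∖ S′) (S′ ==_) R) t) = qR , T-not⇒¬T t¬
    m-through : ∀ R → T (m (insertAt R i true)) → S′ ≡ R
    m-through R t = ==-sound S′ R (subst T (through-merge (q ∖ S′) (S′ ==_) R) t)
    S′-apart : ∀ {R} → T (q R) × ¬ T (S′ == R) → ¬ Overlap S′ R
    S′-apart {R} (qR , S′≠R) common =
      [ (λ qS′ → S′≠R (subst (T ∘ (S′ ==_)) (disjoint Q qS′ qR common) (==-refl S′)))
      , (λ S′≡∅ → ¬Overlap-∅ R (subst (λ Z → Overlap Z R) S′≡∅ common)) ] S′-allowed
    nonEmpty′ : ∀ {V} → T (m V) → NonEmpty V
    nonEmpty′ {V} t with splitAt V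
    ... | split R false = NonEmpty-insertAt⁺ false (nonEmpty Q (proj₁ (m-avoiding R t)))
    ... | split R true  = NonEmpty-insertAt-true R
    disjoint′ : ∀ {V V′} → T (m V) → T (m V′) → Overlap V V′ → V ≡ V′
    disjoint′ {V} {V′} t t′ common with splitAt V | splitAt V′
    ... | split R true | split R′ true =
      cong (λ Z → insertAt Z i true) (trans (sym (m-through R t)) (m-through R′ t′))
    ... | split R false | split R′ false with Overlap-insertAt⁻ {R} {R′} common
    ...   | inj₁ (() , _)
    ...   | inj₂ common′ = cong (λ Z → insertAt Z i false)
                             (disjoint Q (proj₁ (m-avoiding R t)) (proj₁ (m-avoiding R′ t′)) common′)
    disjoint′ t t′ common | split R true | split R′ false with Overlap-insertAt⁻ {R} {R′} common
    ...   | inj₁ (_ , ())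
    ...   | inj₂ common′ = ⊥-elim (S′-apart (m-avoiding R′ t′)
                             (subst (λ Z → Overlap Z R′) (sym (m-through R t)) common′))
    disjoint′ t t′ common | split R false | split R′ true with Overlap-insertAt⁻ {R} {R′} common
    ...   | inj₁ (() , _)
    ...   | inj₂ common′ = ⊥-elim (S′-apart (m-avoiding R t)
                             (subst (λ Z → Overlap Z R) (sym (m-through R′ t′)) (Overlap-sym {S = R} {R′} common′)))
    covers′ : ∀ k → ∃[ V ] T (m V) × T (lookup V k)
    covers′ k with coordinate k
    ... | inj₁ refl = insertAt S′ i true , subst T (sym (through-merge (q ∖ S′) (S′ ==_) S′)) (==-refl S′) ,
                      i∈insertAt-true S′
    ... | inj₂ (j , refl) with covers Q j
    ...   | R , qR , j∈R with T? (S′ == R)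
    ...     | yes S′==R = insertAt R i true , subst T (sym (through-merge (q ∖ S′) (S′ ==_) R)) S′==R ,
                          ∈-insertAt-punchIn⁺ R true j j∈R
    ...     | no  S′≠R  = insertAt R i false ,
                          subst T (sym (avoiding-merge (q ∖ S′) (S′ ==_) R)) (from T-∧ (qR , ¬T⇒T-not S′≠R)) ,
                          ∈-insertAt-punchIn⁺ R false j j∈R

  deleteBlock : SetSys (suc n) → SetSys n
  deleteBlock X = tabulateₛ (avoiding ⟦ X ⟧)

  deleteElement : SetSys (suc n) → SetSys n
  deleteElement X = tabulateₛ (λ R → avoiding ⟦ X ⟧ R ∨ through ⟦ X ⟧ R)

  -- Puts i into the part S′ of A, or adds the new part {i} when S′ = ∅.
  insertInto : Subset n → SetSys n → SetSys (suc n)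
  insertInto S′ A = tabulateₛ (merge (⟦ A ⟧ ∖ S′) (S′ ==_))

  ⟦insertInto⟧ : (S′ : Subset n) (A : SetSys n) → ⟦ insertInto S′ A ⟧ ≗ merge (⟦ A ⟧ ∖ S′) (S′ ==_)
  ⟦insertInto⟧ S′ A = ⟦⟧-tabulateₛ (merge (⟦ A ⟧ ∖ S′) (S′ ==_))

  deleteBlock-insertInto : {S′ : Subset n} (A : SetSys n) → ¬ T (⟦ A ⟧ S′) → deleteBlock (insertInto S′ A) ≡ A
  deleteBlock-insertInto {S′} A S′∉A = SetSys-ext λ R → begin
    ⟦ deleteBlock (insertInto S′ A) ⟧ R ≡⟨ ⟦⟧-tabulateₛ (avoiding ⟦ insertInto S′ A ⟧) R ⟩
    ⟦ insertInto S′ A ⟧ (insertAt R i false) ≡⟨ ⟦insertInto⟧ S′ A (insertAt R i false) ⟩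
    merge (⟦ A ⟧ ∖ S′) (S′ ==_) (insertAt R i false) ≡⟨ avoiding-merge (⟦ A ⟧ ∖ S′) (S′ ==_) R ⟩
    (⟦ A ⟧ ∖ S′) R ≡⟨ ∖-absent ⟦ A ⟧ S′∉A R ⟩
    ⟦ A ⟧ R ∎
    where open ≡-Reasoning

  deleteElement-insertInto : {S′ : Subset n} (A : SetSys n) → T (⟦ A ⟧ S′) → deleteElement (insertInto S′ A) ≡ A
  deleteElement-insertInto {S′} A S′∈A = SetSys-ext λ R → begin
    ⟦ deleteElement (insertInto S′ A) ⟧ R
      ≡⟨ ⟦⟧-tabulateₛ (λ R → avoiding ⟦ insertInto S′ A ⟧ R ∨ through ⟦ insertInto S′ A ⟧ R) R ⟩
    avoiding ⟦ insertInto S′ A ⟧ R ∨ through ⟦ insertInto S′ A ⟧ R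
      ≡⟨ cong₂ _∨_ (trans (⟦insertInto⟧ S′ A (insertAt R i false)) (avoiding-merge (⟦ A ⟧ ∖ S′) (S′ ==_) R))
                   (trans (⟦insertInto⟧ S′ A (insertAt R i true)) (through-merge (⟦ A ⟧ ∖ S′) (S′ ==_) R)) ⟩
    (⟦ A ⟧ ∖ S′) R ∨ (S′ == R)
      ≡⟨ ∖-∨ ⟦ A ⟧ S′∈A R ⟩
    ⟦ A ⟧ R ∎
    where open ≡-Reasoning

  insertInto-deleteBlock : {S′ : Subset n} (X : SetSys (suc n)) → through ⟦ X ⟧ ≗ (S′ ==_) →
    ¬ T (avoiding ⟦ X ⟧ S′) → insertInto S′ (deleteBlock X) ≡ X
  insertInto-deleteBlock {S′} X block S′∉X = SetSys-ext λ V → begin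
    ⟦ insertInto S′ (deleteBlock X) ⟧ V            ≡⟨ ⟦insertInto⟧ S′ (deleteBlock X) V ⟩
    merge (⟦ deleteBlock X ⟧ ∖ S′) (S′ ==_) V      ≡⟨ merge-cong avoiding≗ (sym ∘ block) V ⟩
    merge (avoiding ⟦ X ⟧) (through ⟦ X ⟧) V       ≡⟨ merge-sections ⟦ X ⟧ V ⟩
    ⟦ X ⟧ V ∎
    where
    open ≡-Reasoning
    avoiding≗ : ⟦ deleteBlock X ⟧ ∖ S′ ≗ avoiding ⟦ X ⟧
    avoiding≗ R = trans (∖-absent ⟦ deleteBlock X ⟧ (S′∉X ∘ ∈-tabulateₛ⁻ (avoiding ⟦ X ⟧)) R)
                        (⟦⟧-tabulateₛ (avoiding ⟦ X ⟧) R)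

  insertInto-deleteElement : {S′ : Subset n} (X : SetSys (suc n)) → through ⟦ X ⟧ ≗ (S′ ==_) →
    ¬ T (avoiding ⟦ X ⟧ S′) → insertInto S′ (deleteElement X) ≡ X
  insertInto-deleteElement {S′} X block S′∉X = SetSys-ext λ V → begin
    ⟦ insertInto S′ (deleteElement X) ⟧ V          ≡⟨ ⟦insertInto⟧ S′ (deleteElement X) V ⟩
    merge (⟦ deleteElement X ⟧ ∖ S′) (S′ ==_) V    ≡⟨ merge-cong avoiding≗ (sym ∘ block) V ⟩
    merge (avoiding ⟦ X ⟧) (through ⟦ X ⟧) V       ≡⟨ merge-sections ⟦ X ⟧ V ⟩
    ⟦ X ⟧ V ∎
    where
    open ≡-Reasoning
    avoiding≗ : ⟦ deleteElement X ⟧ ∖ S′ ≗ avoiding ⟦ X ⟧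
    avoiding≗ R = trans (cong (λ b → b ∧ not (S′ == R))
                              (trans (⟦⟧-tabulateₛ (λ R → avoiding ⟦ X ⟧ R ∨ through ⟦ X ⟧ R) R)
                                     (cong (avoiding ⟦ X ⟧ R ∨_) (block R))))
                        (∨-∖ (avoiding ⟦ X ⟧) S′∉X R)

  count-merge : (a b : Predᵇ n) → count (merge a b) ≡ count a + count b
  count-merge a b = trans (count-insertAt i (merge a b))
    (cong₂ _+_ (count-cong (avoiding-merge a b)) (count-cong (through-merge a b)))

  size-insertInto-new : {S′ : Subset n} (A : SetSys n) → ¬ T (⟦ A ⟧ S′) → size (insertInto S′ A) ≡ suc (size A)
  size-insertInto-new {S′} A S′∉A = begin
    size (insertInto S′ A)               ≡⟨ count-cong (⟦insertInto⟧ S′ A) ⟩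
    count (merge (⟦ A ⟧ ∖ S′) (S′ ==_))  ≡⟨ count-merge (⟦ A ⟧ ∖ S′) (S′ ==_) ⟩
    count (⟦ A ⟧ ∖ S′) + count (S′ ==_)  ≡⟨ cong₂ _+_ (count-cong (∖-absent ⟦ A ⟧ S′∉A)) (count-== S′) ⟩
    size A + 1                           ≡⟨ +-comm (size A) 1 ⟩
    suc (size A) ∎
    where open ≡-Reasoning

  size-insertInto-old : {S′ : Subset n} (A : SetSys n) → T (⟦ A ⟧ S′) → size (insertInto S′ A) ≡ size A
  size-insertInto-old {S′} A S′∈A = begin
    size (insertInto S′ A)                    ≡⟨ count-cong (⟦insertInto⟧ S′ A) ⟩
    count (merge (⟦ A ⟧ ∖ S′) (S′ ==_))       ≡⟨ count-merge (⟦ A ⟧ ∖ S′) (S′ ==_) ⟩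
    count (⟦ A ⟧ ∖ S′) + count (S′ ==_)       ≡⟨ sym (count-∨ (⟦ A ⟧ ∖ S′) (S′ ==_) apart) ⟩
    count (λ R → (⟦ A ⟧ ∖ S′) R ∨ (S′ == R))  ≡⟨ count-cong (∖-∨ ⟦ A ⟧ S′∈A) ⟩
    size A ∎
    where
    open ≡-Reasoning
    apart : ∀ R → T ((⟦ A ⟧ ∖ S′) R) → ¬ T (S′ == R)
    apart R t = T-not⇒¬T (proj₂ (to (T-∧ {⟦ A ⟧ R}) t))

  size-deleteBlock : {S′ : Subset n} (X : SetSys (suc n)) → through ⟦ X ⟧ ≗ (S′ ==_) →
    ¬ T (avoiding ⟦ X ⟧ S′) → suc (size (deleteBlock X)) ≡ size X
  size-deleteBlock {S′} X block S′∉X = begin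
    suc (size (deleteBlock X))
      ≡⟨ size-insertInto-new (deleteBlock X) (S′∉X ∘ ∈-tabulateₛ⁻ (avoiding ⟦ X ⟧)) ⟨
    size (insertInto S′ (deleteBlock X))
      ≡⟨ cong size (insertInto-deleteBlock X block S′∉X) ⟩
    size X ∎
    where open ≡-Reasoning

  size-deleteElement : {S′ : Subset n} (X : SetSys (suc n)) → through ⟦ X ⟧ ≗ (S′ ==_) →
    ¬ T (avoiding ⟦ X ⟧ S′) → size (deleteElement X) ≡ size X
  size-deleteElement {S′} X block S′∉X = begin
    size (deleteElement X)                 ≡⟨ size-insertInto-old (deleteElement X) S′∈ ⟨
    size (insertInto S′ (deleteElement X)) ≡⟨ cong size (insertInto-deleteElement X block S′∉X) ⟩
    size X ∎
    where
    open ≡-Reasoning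
    S′∈ : T (⟦ deleteElement X ⟧ S′)
    S′∈ = ∈-tabulateₛ⁺ (λ R → avoiding ⟦ X ⟧ R ∨ through ⟦ X ⟧ R)
            (from T-∨ (inj₂ (subst T (sym (block S′)) (==-refl S′))))

  merge-mono : {a a′ b b′ : Predᵇ n} → a ⊆ᵇ a′ → b ⊆ᵇ b′ → merge a b ⊆ᵇ merge a′ b′
  merge-mono a⊆a′ b⊆b′ V with lookup V i
  ... | false = a⊆a′ (removeAt V i)
  ... | true  = b⊆b′ (removeAt V i)

  #P-deleteBlock : ∀ r (𝒯 : SetSys (suc n)) → through ⟦ 𝒯 ⟧ ≗ (∅ ==_) →
    #P (suc n) (suc r) 𝒯 ≡ #P n r (deleteBlock 𝒯)
  #P-deleteBlock r 𝒯 block = #P-≡ deleteBlock (insertInto ∅) deleteBlock-maps insertInto-maps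
    (λ X∈ → insertInto-deleteBlock _ (blockX X∈) (∅∉X X∈))
    (λ A∈ → deleteBlock-insertInto _ (∅-not-part (isPartition A∈)))
    where
    𝒯∅ : T (through ⟦ 𝒯 ⟧ ∅)
    𝒯∅ = subst T (sym (block ∅)) (==-refl {n} ∅)
    module _ {X : SetSys (suc n)} (X∈ : PartitionContaining (suc r) 𝒯 X) where
      blockX : through ⟦ X ⟧ ≗ (∅ ==_)
      blockX = through-block {⟦ X ⟧} {⟦ X ⟧} (isPartition X∈) (λ _ X∋ → X∋) (contains X∈ (insertAt ∅ i true) 𝒯∅)
      ∅∉X : ¬ T (avoiding ⟦ X ⟧ ∅)
      ∅∉X = avoiding-block {⟦ X ⟧} (isPartition X∈) (contains X∈ (insertAt ∅ i true) 𝒯∅)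
      deleteBlock-maps : PartitionContaining r (deleteBlock 𝒯) (deleteBlock X)
      deleteBlock-maps .isPartition = IsPartition-cong (sym ∘ ⟦⟧-tabulateₛ (avoiding ⟦ X ⟧))
        (IsPartition-avoiding {⟦ X ⟧} (isPartition X∈) (contains X∈ (insertAt ∅ i true) 𝒯∅))
      deleteBlock-maps .size≡ = suc-injective (trans (size-deleteBlock X blockX ∅∉X) (size≡ X∈))
      deleteBlock-maps .contains =
        λ R → ∈-tabulateₛ⁺ (avoiding ⟦ X ⟧) ∘ contains X∈ (insertAt R i false) ∘ ∈-tabulateₛ⁻ (avoiding ⟦ 𝒯 ⟧)
    module _ {A : SetSys n} (A∈ : PartitionContaining r (deleteBlock 𝒯) A) where
      insertInto-maps : PartitionContaining (suc r) 𝒯 (insertInto ∅ A)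
      insertInto-maps .isPartition = IsPartition-cong (sym ∘ ⟦insertInto⟧ ∅ A)
        (IsPartition-merge {⟦ A ⟧} (isPartition A∈) (inj₂ refl))
      insertInto-maps .size≡ = trans (size-insertInto-new A (∅-not-part (isPartition A∈))) (cong suc (size≡ A∈))
      insertInto-maps .contains V t = subst T (sym (⟦insertInto⟧ ∅ A V))
        (merge-mono avoiding⊆ (λ R → subst T (block R)) V (subst T (sym (merge-sections ⟦ 𝒯 ⟧ V)) t))
        where
        avoiding⊆ : avoiding ⟦ 𝒯 ⟧ ⊆ᵇ (⟦ A ⟧ ∖ ∅)
        avoiding⊆ R t = subst T (sym (∖-absent ⟦ A ⟧ (∅-not-part (isPartition A∈)) R))
          (contains A∈ R (∈-tabulateₛ⁺ (avoiding ⟦ 𝒯 ⟧) t))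

  #P-deleteElement : ∀ r (𝒯 : SetSys (suc n)) {S′ : Subset n} → through ⟦ 𝒯 ⟧ ≗ (S′ ==_) → NonEmpty S′ →
    #P (suc n) r 𝒯 ≤ #P n r (deleteElement 𝒯)
  #P-deleteElement r 𝒯 {S′} block (j , j∈S′) =
    #P-≤ deleteElement (insertInto S′) deleteElement-maps (λ X∈ → insertInto-deleteElement _ (blockX X∈) (S′∉X X∈))
    where
    𝒯S′ : T (through ⟦ 𝒯 ⟧ S′)
    𝒯S′ = subst T (sym (block S′)) (==-refl S′)
    module _ {X : SetSys (suc n)} (X∈ : PartitionContaining r 𝒯 X) where
      blockX : through ⟦ X ⟧ ≗ (S′ ==_)
      blockX = through-block {⟦ X ⟧} {⟦ X ⟧} (isPartition X∈) (λ _ X∋ → X∋) (contains X∈ (insertAt S′ i true) 𝒯S′)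
      S′∉X : ¬ T (avoiding ⟦ X ⟧ S′)
      S′∉X = avoiding-block {⟦ X ⟧} (isPartition X∈) (contains X∈ (insertAt S′ i true) 𝒯S′)
      ¬X∅ : ¬ T (through ⟦ X ⟧ ∅)
      ¬X∅ X∅ = ∉∅ j (subst (λ Z → T (lookup Z j)) (==-sound S′ ∅ (subst T (blockX ∅) X∅)) j∈S′)
      deleteElement-maps : PartitionContaining r (deleteElement 𝒯) (deleteElement X)
      deleteElement-maps .isPartition =
        IsPartition-cong (sym ∘ ⟦⟧-tabulateₛ (λ R → avoiding ⟦ X ⟧ R ∨ through ⟦ X ⟧ R))
          (IsPartition-deleteElement {⟦ X ⟧} (isPartition X∈) ¬X∅)
      deleteElement-maps .size≡ = trans (size-deleteElement X blockX S′∉X) (size≡ X∈)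
      deleteElement-maps .contains R t = ∈-tabulateₛ⁺ (λ R → avoiding ⟦ X ⟧ R ∨ through ⟦ X ⟧ R)
        (from T-∨ (Sum.map (contains X∈ (insertAt R i false)) (contains X∈ (insertAt R i true))
          (to (T-∨ {avoiding ⟦ 𝒯 ⟧ R}) (∈-tabulateₛ⁻ (λ R → avoiding ⟦ 𝒯 ⟧ R ∨ through ⟦ 𝒯 ⟧ R) t))))

-- The two bounds

somePart : SetSys n → Subset n
somePart X with members X
... | []    = ∅
... | S ∷ _ = S

somePart-∈ : (X : SetSys n) → size X ≡ suc k → T (⟦ X ⟧ (somePart X))
somePart-∈ X size≡ with members X in eq
... | S ∷ _ = ∈-members⁻ X (subst (S ∈_) (sym eq) (here refl))

s-monoˡ-step : ∀ m k → s m (suc k) ≤ s (suc m) (suc k)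
s-monoˡ-step m k = subst₂ _≤_ (#P-∅ₛ m (suc k)) (#P-∅ₛ (suc m) (suc k))
  (#P-≤ (λ X → insertInto (somePart X) X) deleteElement maps
        (λ {X} X∈ → deleteElement-insertInto X (somePart-∈ X (size≡ X∈))))
  where
  open Coordinate {m} zero
  maps : ∀ {X} → PartitionContaining (suc k) ∅ₛ X → PartitionContaining (suc k) ∅ₛ (insertInto (somePart X) X)
  maps {X} X∈ .isPartition = IsPartition-cong (sym ∘ ⟦insertInto⟧ (somePart X) X)
    (IsPartition-merge {⟦ X ⟧} (isPartition X∈) (inj₁ (somePart-∈ X (size≡ X∈))))
  maps {X} X∈ .size≡ = trans (size-insertInto-old X (somePart-∈ X (size≡ X∈))) (size≡ X∈)
  maps {X} X∈ .contains V = ⊥-elim ∘ ∉∅ₛ V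

s-mono-∸ : ∀ m t {r} → t < r → s (m ∸ suc t) (r ∸ t) ≤ s (m ∸ t) (r ∸ t)
s-mono-∸ zero    zero    {suc k} _         = ≤-refl
s-mono-∸ (suc m) zero    {suc k} _         = s-monoˡ-step m k
s-mono-∸ zero    (suc t) {suc r} _         = ≤-refl
s-mono-∸ (suc m) (suc t) {suc r} (s≤s t<r) = s-mono-∸ m t t<r

#P-upper : ∀ n r t (𝒯 : SetSys n) → size 𝒯 ≡ t → t < r → #P n r 𝒯 ≤ s (n ∸ t) (r ∸ t)
#P-upper-step : ∀ n r t (𝒯 : SetSys n) → size 𝒯 ≡ suc t → suc t < r → ∀ {Y} →
  PartitionContaining r 𝒯 Y → #P n r 𝒯 ≤ s (n ∸ suc t) (r ∸ suc t)

#P-upper n r zero    𝒯 _     _   = #P≤s n r 𝒯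
#P-upper n r (suc t) 𝒯 size≡ t<r with P n r [ 𝒯 ] in eq
... | []     = z≤n
... | Y ∷ Ys = subst (_≤ s (n ∸ suc t) (r ∸ suc t)) (cong length eq)
                 (#P-upper-step n r t 𝒯 size≡ t<r (∈-P[]⁻ 𝒯 Y (subst (Y ∈_) (sym eq) (here refl))))

#P-upper-step zero    r       t 𝒯 size≡ _ Y∈
  with () ← proj₁ (nonEmpty (isPartition Y∈) {somePart 𝒯} (contains Y∈ (somePart 𝒯) (somePart-∈ 𝒯 size≡)))
#P-upper-step (suc n) (suc r) t 𝒯 size≡ (s≤s t<r) {Y} Y∈ = by-block (T? (nonemptyᵇ S′))
  where
  U : Subset (suc n)
  U = somePart 𝒯
  U∈𝒯 : T (⟦ 𝒯 ⟧ U)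
  U∈𝒯 = somePart-∈ 𝒯 size≡
  i∈U : NonEmpty U
  i∈U = nonEmpty (isPartition Y∈) {U} (contains Y∈ U U∈𝒯)
  i : Fin (suc n)
  i = proj₁ i∈U
  open Coordinate i
  S′ : Subset n
  S′ = removeAt U i
  𝒯S′ : T (through ⟦ 𝒯 ⟧ S′)
  𝒯S′ = subst (T ∘ ⟦ 𝒯 ⟧)
    (sym (trans (cong (insertAt S′ i) (sym (to T-≡ (proj₂ i∈U)))) (insertAt-removeAt U i))) U∈𝒯
  block : through ⟦ 𝒯 ⟧ ≗ (S′ ==_)
  block = through-block {⟦ 𝒯 ⟧} {⟦ Y ⟧} {S′} (isPartition Y∈) (contains Y∈) 𝒯S′
  S′∉𝒯 : ¬ T (avoiding ⟦ 𝒯 ⟧ S′)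
  S′∉𝒯 = avoiding-block {⟦ Y ⟧} {S′} (isPartition Y∈) (contains Y∈ (insertAt S′ i true) 𝒯S′)
       ∘ contains Y∈ (insertAt S′ i false)
  open ≤-Reasoning
  by-block : Dec (T (nonemptyᵇ S′)) → #P (suc n) (suc r) 𝒯 ≤ s (n ∸ t) (r ∸ t)
  by-block (no S′-empty) = begin
    #P (suc n) (suc r) 𝒯   ≡⟨ #P-deleteBlock r 𝒯 (λ R → trans (block R) (cong (_== R) S′≡∅)) ⟩
    #P n r (deleteBlock 𝒯) ≤⟨ #P-upper n r t (deleteBlock 𝒯) size≡t t<r ⟩
    s (n ∸ t) (r ∸ t)      ∎
    where
    S′≡∅ : S′ ≡ ∅
    S′≡∅ = ¬nonemptyᵇ⇒≡∅ S′ S′-empty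
    size≡t : size (deleteBlock 𝒯) ≡ t
    size≡t = suc-injective (trans (size-deleteBlock {S′} 𝒯 block S′∉𝒯) size≡)
  by-block (yes S′-nonempty) = begin
    #P (suc n) (suc r) 𝒯             ≤⟨ #P-deleteElement (suc r) 𝒯 {S′} block (nonemptyᵇ⇒NonEmpty S′ S′-nonempty) ⟩
    #P n (suc r) (deleteElement 𝒯)   ≤⟨ #P-upper n (suc r) (suc t) (deleteElement 𝒯)
                                          (trans (size-deleteElement {S′} 𝒯 block S′∉𝒯) size≡) (s≤s t<r) ⟩
    s (n ∸ suc t) (r ∸ t)            ≤⟨ s-mono-∸ n t t<r ⟩
    s (n ∸ t) (r ∸ t)                ∎

-- {{0}, {1}, …, {t − 1}}
firstSingletons : ∀ {t} → t ≤ n → SetSys n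
firstSingletons         z≤n       = ∅ₛ
firstSingletons {suc n} (s≤s t≤n) = firstSingletons t≤n , tabulateₛ (∅ ==_)

size-firstSingletons : ∀ {t} (t≤n : t ≤ n) → size (firstSingletons t≤n) ≡ t
size-firstSingletons {n} z≤n = size-∅ₛ {n}
size-firstSingletons {suc n} {suc t} (s≤s t≤n) = begin
  size (firstSingletons (s≤s t≤n))
    ≡⟨ count-head ⟦ firstSingletons (s≤s t≤n) ⟧ ⟩
  size (firstSingletons t≤n) + size (tabulateₛ {n} (∅ ==_))
    ≡⟨ cong₂ _+_ (size-firstSingletons t≤n) (trans (size-tabulateₛ {n} (∅ ==_)) (count-== {n} ∅)) ⟩
  t + 1
    ≡⟨ +-comm t 1 ⟩
  suc t ∎
  where open ≡-Reasoning

#P-firstSingletons : ∀ {t} r (t≤n : t ≤ n) → t ≤ r → #P n r (firstSingletons t≤n) ≡ s (n ∸ t) (r ∸ t)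
#P-firstSingletons {n} r z≤n _ = #P-∅ₛ n r
#P-firstSingletons {suc n} {suc t} (suc r) (s≤s t≤n) (s≤s t≤r) = begin
  #P (suc n) (suc r) (firstSingletons (s≤s t≤n))
    ≡⟨ #P-deleteBlock r (firstSingletons (s≤s t≤n)) (⟦⟧-tabulateₛ {n} (∅ ==_)) ⟩
  #P n r (tabulateₛ ⟦ firstSingletons t≤n ⟧)
    ≡⟨ cong (#P n r) (SetSys-ext (⟦⟧-tabulateₛ ⟦ firstSingletons t≤n ⟧)) ⟩
  #P n r (firstSingletons t≤n)
    ≡⟨ #P-firstSingletons r t≤n t≤r ⟩
  s (n ∸ t) (r ∸ t) ∎
  where
  open ≡-Reasoning
  open Coordinate {n} zero

l≤v⁺ : (F : Family n) (t b : ℕ) → (∀ 𝒯 → size 𝒯 ≡ t → length (F [ 𝒯 ]) ≤ b) → l F t ≤ b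
l≤v⁺ {n} F t b bound = foldr-preservesᵇ {P = _≤ b} {f = _⊔_} ⊔-lub z≤n
  (All.map⁺ (All.tabulate λ {𝒯} 𝒯∈ →
    bound 𝒯 (≡ᵇ⇒≡ (size 𝒯) t (proj₂ (∈-filter⁻ (T? ∘ λ 𝒯 → size 𝒯 ≡ᵇ t) {xs = allSetSys n} 𝒯∈)))))

F[T]≤l : (F : Family n) (t : ℕ) (𝒯 : SetSys n) → size 𝒯 ≡ t → length (F [ 𝒯 ]) ≤ l F t
F[T]≤l {n} F t 𝒯 size≡ = foldr-preservesᵒ {P = length (F [ 𝒯 ]) ≤_} {f = _⊔_}
  (λ x y → [ m≤n⇒m≤n⊔o y , m≤n⇒m≤o⊔n x ]) 0 _
  (inj₂ (lose (∈-map⁺ (λ 𝒯 → length (F [ 𝒯 ]))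
                (∈-filter⁺ (T? ∘ λ 𝒯 → size 𝒯 ≡ᵇ t) (allSetSys-complete 𝒯) (≡⇒≡ᵇ (size 𝒯) t size≡)))
              ≤-refl))

lemma4p13 : (n r t : ℕ) → 1 ≤ t → t < r → r ≤ n →
    l (P n r) t ≡ s (n ∸ t) (r ∸ t)
lemma4p13 n r t _ t<r r≤n = ≤-antisym
  (l≤v⁺ (P n r) t _ λ 𝒯 size≡ → #P-upper n r t 𝒯 size≡ t<r)
  (subst (_≤ l (P n r) t) (#P-firstSingletons r t≤n (<⇒≤ t<r))
    (F[T]≤l (P n r) t (firstSingletons t≤n) (size-firstSingletons t≤n)))
  where
  t≤n : t ≤ n
  t≤n = ≤-trans (<⇒≤ t<r) r≤n
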